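{- Let $\Delta$ be a positive integer. If $G$ is a $\rho$-$\Delta$-critical graph, then $G$ contains no edge $uv$ with $\deg_G(u)=2$ and $\deg_G(v)\leq\Delta-2$.
   Context: All graphs are simple. For a graph $G$, an incidence is a pair $(v,e)$ with $v$ an endpoint of the edge $e$; $I(G)$ is the set of incidences. For $u\in V(G)$ and a neighbor $v$, $(u,uv)$ is a strong incidence of $u$ and $(v,uv)$ is a weak incidence of $u$; $I_u$, $A_u$ denote the sets of strong, resp. weak, incidences of $u$. Let $[\Delta]=\{1,\dots,\Delta\}$. A conditional incidence $\Delta$-coloring of $G$ is a map $\varphi: I(G)\to[\Delta]$ such that: (a) $(u,uv)$ and $(v,uv)$ receive distinct colors for each edge $uv$; (b) each color appears at most once among $A_u$ for each vertex $u$; (c) each color appears at most once among $I_u$ for each vertex $u$; (d) each color of $[\Delta]$ appears at least once among $A_u\cup I_u$ for each vertex $u$ with $\deg_G(u)\geq\Delta-1$. A graph $G$ is $\rho$-$\Delta$-critical if $\Delta(G)\leq\Delta$, $G$ has no conditional incidence $\Delta$-coloring, but every proper subgraph of $G$ has one. -}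

module Defs where

open import Data.Nat using (ℕ; zero; suc; _+_; _≤_; _∸_)
open import Data.Fin using (Fin)
open import Data.Bool using (Bool; true; false; if_then_else_)
open import Data.List using (List; map; allFin)
open import Data.Nat.ListAction using (sum)
open import Data.Product using (Σ; ∃; ∃-syntax; _×_; _,_)
open import Data.Sum using (_⊎_)
open import Data.Empty using (⊥)
open import Relation.Nullary using (¬_)
open import Relation.Binary.PropositionalEquality using (_≡_; _≢_)

record Graph : Set where
  field
    n     : ℕ
    adj   : Fin n → Fin n → Bool
    sym   : ∀ u v → adj u v ≡ adj v u
    irrefl : ∀ u → adj u u ≡ false
open Graph public

Adj : (G : Graph) → Fin (n G) → Fin (n G) → Set
Adj G u v = adj G u v ≡ true

deg : (G : Graph) → Fin (n G) → ℕ
deg G u = sum (map (λ v → if adj G u v then 1 else 0) (allFin (n G)))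

MaxDeg≤ : Graph → ℕ → Set
MaxDeg≤ G Δ = ∀ u → deg G u ≤ Δ

-- A colouring of incidences: φ u v is the colour of the incidence (u , uv)
-- (only values on edges uv are relevant).  Colours [Δ] are Fin Δ.
record CondIncColoring (G : Graph) (Δ : ℕ) : Set where
  field
    φ : Fin (n G) → Fin (n G) → Fin Δ
    condA : ∀ u v → Adj G u v → φ u v ≢ φ v u
    -- (b) weak incidences (v,uv) of u get pairwise distinct colours
    condB : ∀ u v w → Adj G u v → Adj G u w → φ v u ≡ φ w u → v ≡ w
    -- (c) strong incidences (u,uv) of u get pairwise distinct colours
    condC : ∀ u v w → Adj G u v → Adj G u w → φ u v ≡ φ u w → v ≡ w
    condD : ∀ u → Δ ∸ 1 ≤ deg G u → ∀ (c : Fin Δ) →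
            ∃[ v ] (Adj G u v × (φ u v ≡ c ⊎ φ v u ≡ c))

HasCondIncColoring : Graph → ℕ → Set
HasCondIncColoring G Δ = CondIncColoring G Δ

record SubgraphEmb (H G : Graph) : Set where
  field
    f     : Fin (n H) → Fin (n G)
    inj   : ∀ x y → f x ≡ f y → x ≡ y
    edges : ∀ x y → Adj H x y → Adj G (f x) (f y)
open SubgraphEmb public

Proper : {H G : Graph} → SubgraphEmb H G → Set
Proper {H} {G} e =
  (∃[ w ] ∀ x → f e x ≢ w) ⊎
  (∃[ x ] ∃[ y ] (Adj G (f e x) (f e y) × ¬ Adj H x y))

ρCritical : ℕ → Graph → Set
ρCritical Δ G =
  MaxDeg≤ G Δ ×
  ¬ HasCondIncColoring G Δ ×
  (∀ (H : Graph) (e : SubgraphEmb H G) → Proper e → HasCondIncColoring H Δ)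

-- Delete the edge uv and colour G − uv by criticality; let w be the other
-- neighbour of u.  Give (u,uv) a colour a avoiding both colours on the edge uw
-- and the weak colours at v, and (v,uv) a colour b avoiding a, the weak colour
-- at u and the strong colours at v.  Each avoids 2 + deg(v) − 1 ≤ Δ − 1 colours,
-- so both exist.  Condition (d) is vacuous at v since deg v ≤ Δ − 2, and at u it
-- only bites when Δ = 3, where the three pairwise distinct colours a, φ(u,w),
-- φ(w,u) exhaust [Δ].  So G is colourable after all, contradicting criticality.
module Submission where

open import Defs hiding (sym)
open import Data.Nat using (ℕ; zero; suc; _+_; _≤_; _<_; _∸_; _>_; z≤n; s≤s)
open import Data.Nat.Properties using (≤-trans; ≤⇒≯; n≮n; +-suc; suc-injective)
open import Data.Fin using (Fin; zero; suc; _≟_)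
open import Data.Fin.Properties using (injective⇒≤; ¬∀⟶∃¬)
open import Data.Bool using (Bool; true; false; not; _∧_; if_then_else_) renaming (_≟_ to _≟ᵇ_)
open import Data.Bool.Properties using (∧-zeroʳ)
open import Data.List using (List; []; _∷_; map; allFin; length; lookup; filter)
open import Data.List.Properties using (length-map; map-cong-local)
open import Data.Nat.ListAction using (sum)
open import Data.List.Membership.Propositional using (_∈_; _∉_)
open import Data.List.Membership.Propositional.Properties using (∈-allFin; ∈-map⁺; ∈-lookup; ∈-filter⁺; ∈-filter⁻)
open import Data.List.Relation.Unary.Any using (here; there; index; any?) renaming (map to Any-map)
open import Data.List.Relation.Unary.Any.Properties using (lookup-index; singleton⁻)
open import Data.List.Relation.Unary.All as All using (All; []; _∷_)
open import Data.List.Relation.Unary.All.Properties using (¬Any⇒All¬)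
open import Data.List.Relation.Unary.AllPairs using ([]; _∷_)
open import Data.List.Relation.Unary.Unique.Propositional using (Unique)
open import Data.List.Relation.Unary.Unique.Propositional.Properties using (allFin⁺)
open import Data.Product using (∃-syntax; _×_; _,_; proj₁; proj₂; swap)
open import Data.Sum using (_⊎_; inj₁; inj₂; [_,_]; [_,_]′; map₁)
open import Data.Empty using (⊥-elim)
open import Relation.Nullary using (¬_; Dec; yes; no; does)
open import Relation.Nullary.Decidable using (_×-dec_; _⊎-dec_; dec-true; dec-false; does-⇔; decidable-stable)
open import Relation.Binary.PropositionalEquality using (_≡_; _≢_; refl; sym; trans; cong; cong₂; subst)
open import Function using (_∘_; id)
open import Function.Bundles using (mk⇔)
open import Function.Definitions using (Injective)

lookup-injective : ∀ {A : Set} {xs : List A} → Unique xs → Injective _≡_ _≡_ (lookup xs)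
lookup-injective (_ ∷ _) {zero} {zero} _ = refl
lookup-injective (x∉ ∷ _) {zero} {suc j} eq = ⊥-elim (All.lookup x∉ (∈-lookup j) eq)
lookup-injective (x∉ ∷ _) {suc i} {zero} eq = ⊥-elim (All.lookup x∉ (∈-lookup i) (sym eq))
lookup-injective (_ ∷ uniq) {suc i} {suc j} eq = cong suc (lookup-injective uniq eq)

Unique⇒length≤ : ∀ {m} {xs : List (Fin m)} → Unique xs → length xs ≤ m
Unique⇒length≤ uniq = injective⇒≤ (lookup-injective uniq)

Unique∧length≥⇒∈ : ∀ {m} {xs : List (Fin m)} → Unique xs → m ≤ length xs → ∀ c → c ∈ xs
Unique∧length≥⇒∈ {xs = xs} uniq m≤ c = decidable-stable (any? (c ≟_) xs) λ c∉ →
  ≤⇒≯ m≤ (Unique⇒length≤ (¬Any⇒All¬ xs c∉ ∷ uniq))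

length<⇒∃∉ : ∀ {m} (xs : List (Fin m)) → length xs < m → ∃[ c ] c ∉ xs
length<⇒∃∉ {m} xs short = ¬∀⟶∃¬ m (_∈ xs) (λ c → any? (c ≟_) xs) λ all∈ →
  ≤⇒≯ (injective⇒≤ (index-injective all∈)) short
  where
  index-injective : (all∈ : ∀ c → c ∈ xs) → Injective _≡_ _≡_ (λ c → index (all∈ c))
  index-injective all∈ {c} {d} eq =
    trans (lookup-index (all∈ c)) (trans (cong (lookup xs) eq) (sym (lookup-index (all∈ d))))

-- Shaped so that deg G x is countᵇ (adj G x) (allFin (n G)) by definition.
countᵇ : ∀ {A : Set} → (A → Bool) → List A → ℕ
countᵇ p xs = sum (map (λ x → if p x then 1 else 0) xs)

countᵇ-cong-local : ∀ {A : Set} {p q : A → Bool} {xs} → All (λ x → p x ≡ q x) xs →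
                    countᵇ p xs ≡ countᵇ q xs
countᵇ-cong-local p≡q = cong sum (map-cong-local (All.map (cong (λ b → if b then 1 else 0)) p≡q))

countᵇ-drop-one : ∀ {A : Set} {p q : A → Bool} {y : A} {xs} → Unique xs → y ∈ xs →
                  p y ≡ true → q y ≡ false → (∀ z → z ≢ y → p z ≡ q z) →
                  countᵇ p xs ≡ suc (countᵇ q xs)
countᵇ-drop-one (y∉ ∷ _) (here refl) py qy agree rewrite py | qy =
  cong suc (countᵇ-cong-local (All.map (λ y≢z → agree _ (y≢z ∘ sym)) y∉))
countᵇ-drop-one {q = q} {xs = x ∷ xs} (x∉ ∷ uniq) (there y∈) py qy agree
  rewrite agree x (All.lookup x∉ y∈) =
  trans (cong (_ +_) (countᵇ-drop-one uniq y∈ py qy agree)) (+-suc _ (countᵇ q xs))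

length-filter-≡true : ∀ {A : Set} (p : A → Bool) xs →
                      length (filter (λ x → p x ≟ᵇ true) xs) ≡ countᵇ p xs
length-filter-≡true p [] = refl
length-filter-≡true p (x ∷ xs) with p x
... | true = cong suc (length-filter-≡true p xs)
... | false = length-filter-≡true p xs

module _ (G : Graph) where

  private
    V : Set
    V = Fin (n G)

  Adj-sym : ∀ {x y : V} → Adj G x y → Adj G y x
  Adj-sym {x} {y} e = trans (Graph.sym G y x) e

  Adj⇒≢ : ∀ {x y : V} → Adj G x y → x ≢ y
  Adj⇒≢ {x} e refl with () ← trans (sym (irrefl G x)) e

  neighbours : V → List V
  neighbours x = filter (λ y → adj G x y ≟ᵇ true) (allFin (n G))

  ∈-neighbours⁺ : ∀ {x y} → Adj G x y → y ∈ neighbours x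
  ∈-neighbours⁺ {y = y} e = ∈-filter⁺ (λ z → adj G _ z ≟ᵇ true) (∈-allFin y) e

  ∈-neighbours⁻ : ∀ {x y} → y ∈ neighbours x → Adj G x y
  ∈-neighbours⁻ {x} y∈ = proj₂ (∈-filter⁻ (λ z → adj G x z ≟ᵇ true) {xs = allFin (n G)} y∈)

  length-neighbours : ∀ x → length (neighbours x) ≡ deg G x
  length-neighbours x = length-filter-≡true (adj G x) (allFin (n G))

  deg≡1⇒unique-neighbour : ∀ {x} → deg G x ≡ 1 → ∃[ w ] (Adj G x w × ∀ {y} → Adj G x y → y ≡ w)
  deg≡1⇒unique-neighbour {x} d≡1
    with neighbours x | ∈-neighbours⁺ {x} | ∈-neighbours⁻ {x} | trans (length-neighbours x) d≡1
  ... | w ∷ [] | ∈⁺ | ∈⁻ | _ = w , ∈⁻ (here refl) , singleton⁻ ∘ ∈⁺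

  module _ (u v : V) where

    Joins : V → V → Set
    Joins x y = (x ≡ u × y ≡ v) ⊎ (x ≡ v × y ≡ u)

    joins? : ∀ x y → Dec (Joins x y)
    joins? x y = (x ≟ u ×-dec y ≟ v) ⊎-dec (x ≟ v ×-dec y ≟ u)

    Joins-sym : ∀ {x y} → Joins x y → Joins y x
    Joins-sym = [ inj₂ ∘ swap , inj₁ ∘ swap ]

    deleteEdge : Graph
    deleteEdge = record
      { n = n G
      ; adj = λ x y → not (does (joins? x y)) ∧ adj G x y
      ; sym = λ x y → cong₂ (λ b c → not b ∧ c)
                        (does-⇔ (mk⇔ Joins-sym Joins-sym) (joins? x y) (joins? y x)) (Graph.sym G x y)
      ; irrefl = λ x → trans (cong (not (does (joins? x x)) ∧_) (irrefl G x)) (∧-zeroʳ _)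
      }

module DeletedEdge {G : Graph} {u v : Fin (n G)} (uv : Adj G u v) where

  private
    H : Graph
    H = deleteEdge G u v

  u≢v : u ≢ v
  u≢v = Adj⇒≢ G uv

  adj-deleteEdge-¬Joins : ∀ {x y} → ¬ Joins G u v x y → adj H x y ≡ adj G x y
  adj-deleteEdge-¬Joins {x} {y} ¬j = cong (λ b → not b ∧ adj G x y) (dec-false (joins? G u v x y) ¬j)

  adj-deleteEdge-Joins : ∀ {x y} → Joins G u v x y → adj H x y ≡ false
  adj-deleteEdge-Joins {x} {y} j = cong (λ b → not b ∧ adj G x y) (dec-true (joins? G u v x y) j)

  ¬Adj-deleteEdge-Joins : ∀ {x y} → Joins G u v x y → ¬ Adj H x y
  ¬Adj-deleteEdge-Joins j e with () ← trans (sym (adj-deleteEdge-Joins j)) e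

  deleteEdge-⊆ : ∀ {x y} → Adj H x y → Adj G x y
  deleteEdge-⊆ {x} {y} e with joins? G u v x y
  ... | yes j = ⊥-elim (¬Adj-deleteEdge-Joins j e)
  ... | no ¬j = trans (sym (adj-deleteEdge-¬Joins ¬j)) e

  deleteEdge-embedding : SubgraphEmb H G
  deleteEdge-embedding = record { f = id ; inj = λ _ _ → id ; edges = λ _ _ → deleteEdge-⊆ }

  deleteEdge-proper : Proper deleteEdge-embedding
  deleteEdge-proper = inj₂ (u , v , uv , ¬Adj-deleteEdge-Joins (inj₁ (refl , refl)))

  endpoint-view : ∀ x → x ≡ u ⊎ x ≡ v ⊎ (x ≢ u × x ≢ v)
  endpoint-view x with x ≟ u | x ≟ v
  ... | yes x≡u | _ = inj₁ x≡u
  ... | no _ | yes x≡v = inj₂ (inj₁ x≡v)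
  ... | no x≢u | no x≢v = inj₂ (inj₂ (x≢u , x≢v))

  Adj-deleteEdge-view : ∀ {x y} → Adj G x y → Joins G u v x y ⊎ Adj H x y
  Adj-deleteEdge-view {x} {y} e with joins? G u v x y
  ... | yes j = inj₁ j
  ... | no ¬j = inj₂ (trans (adj-deleteEdge-¬Joins ¬j) e)

  Adj-deleteEdge-at-u : ∀ {y} → Adj G u y → y ≡ v ⊎ Adj H u y
  Adj-deleteEdge-at-u = map₁ [ proj₂ , ⊥-elim ∘ u≢v ∘ proj₁ ] ∘ Adj-deleteEdge-view

  Adj-deleteEdge-at-v : ∀ {y} → Adj G v y → y ≡ u ⊎ Adj H v y
  Adj-deleteEdge-at-v = map₁ [ ⊥-elim ∘ u≢v ∘ sym ∘ proj₁ , proj₂ ] ∘ Adj-deleteEdge-view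

  Adj-deleteEdge-elsewhere : ∀ {x y} → x ≢ u → x ≢ v → Adj G x y → Adj H x y
  Adj-deleteEdge-elsewhere x≢u x≢v e =
    [ ⊥-elim ∘ [ x≢u ∘ proj₁ , x≢v ∘ proj₁ ] , id ] (Adj-deleteEdge-view e)

  deg-deleteEdge-Joins : ∀ {x y} → Joins G u v x y → Adj G x y → deg G x ≡ suc (deg H x)
  deg-deleteEdge-Joins {x} {y} j e =
    countᵇ-drop-one (allFin⁺ (n G)) (∈-allFin y) e (adj-deleteEdge-Joins j) λ z z≢y →
      sym (adj-deleteEdge-¬Joins (z≢y ∘ Joins-functional j))
    where
    Joins-functional : ∀ {z} → Joins G u v x y → Joins G u v x z → z ≡ y
    Joins-functional (inj₁ (_ , refl)) (inj₁ (_ , refl)) = refl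
    Joins-functional (inj₁ (refl , _)) (inj₂ (u≡v , _)) = ⊥-elim (u≢v u≡v)
    Joins-functional (inj₂ (refl , _)) (inj₁ (v≡u , _)) = ⊥-elim (u≢v (sym v≡u))
    Joins-functional (inj₂ (_ , refl)) (inj₂ (_ , refl)) = refl

  deg-deleteEdge-elsewhere : ∀ {x} → x ≢ u → x ≢ v → deg G x ≡ deg H x
  deg-deleteEdge-elsewhere {x} x≢u x≢v =
    countᵇ-cong-local {p = adj G x} {q = adj H x} {xs = allFin (n G)}
      (All.tabulate λ _ → sym (adj-deleteEdge-¬Joins [ x≢u ∘ proj₁ , x≢v ∘ proj₁ ]))

injective-insert : ∀ {A B : Set} {P : A → Set} {F F′ : A → B} {s : A} {k : B} →
                   (∀ {y} → P y → F′ y ≡ F y) → F′ s ≡ k → (∀ {y} → P y → k ≢ F y) →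
                   (∀ {y z} → P y → P z → F y ≡ F z → y ≡ z) →
                   ∀ {y z} → y ≡ s ⊎ P y → z ≡ s ⊎ P z → F′ y ≡ F′ z → y ≡ z
injective-insert agree Fs≡k fresh inj (inj₁ refl) (inj₁ refl) _ = refl
injective-insert agree Fs≡k fresh inj (inj₁ refl) (inj₂ pz) eq =
  ⊥-elim (fresh pz (trans (sym Fs≡k) (trans eq (agree pz))))
injective-insert agree Fs≡k fresh inj (inj₂ py) (inj₁ refl) eq =
  ⊥-elim (fresh py (trans (sym Fs≡k) (trans (sym eq) (agree py))))
injective-insert agree Fs≡k fresh inj (inj₂ py) (inj₂ pz) eq =
  inj py pz (trans (sym (agree py)) (trans eq (agree pz)))

module ExtendAcrossEdge
  {G : Graph} {u v : Fin (n G)} (uv : Adj G u v) {Δ : ℕ}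
  (ψ : CondIncColoring (deleteEdge G u v) Δ) (a b : Fin Δ)
  (a≢b : a ≢ b)
  (a-fresh-at-u : ∀ {y} → Adj (deleteEdge G u v) u y → a ≢ CondIncColoring.φ ψ u y)
  (b-fresh-at-u : ∀ {y} → Adj (deleteEdge G u v) u y → b ≢ CondIncColoring.φ ψ y u)
  (b-fresh-at-v : ∀ {y} → Adj (deleteEdge G u v) v y → b ≢ CondIncColoring.φ ψ v y)
  (a-fresh-at-v : ∀ {y} → Adj (deleteEdge G u v) v y → a ≢ CondIncColoring.φ ψ y v)
  (spans-u : Δ ∸ 1 ≤ deg G u → ∀ c → c ≡ a ⊎ c ≡ b ⊎
             ∃[ y ] (Adj (deleteEdge G u v) u y ×
                     (CondIncColoring.φ ψ u y ≡ c ⊎ CondIncColoring.φ ψ y u ≡ c)))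
  (spans-v : Δ ∸ 1 ≤ deg G v → ∀ c → c ≡ b ⊎ c ≡ a ⊎
             ∃[ y ] (Adj (deleteEdge G u v) v y ×
                     (CondIncColoring.φ ψ v y ≡ c ⊎ CondIncColoring.φ ψ y v ≡ c)))
  where

  open CondIncColoring ψ
  open DeletedEdge {G} {u} {v} uv

  private
    V : Set
    V = Fin (n G)
    H : Graph
    H = deleteEdge G u v

  colour : V → V → Fin Δ
  colour x y with joins? G u v x y
  ... | yes (inj₁ _) = a
  ... | yes (inj₂ _) = b
  ... | no _ = φ x y

  colour-uv : colour u v ≡ a
  colour-uv with joins? G u v u v
  ... | yes (inj₁ _) = refl
  ... | yes (inj₂ (u≡v , _)) = ⊥-elim (u≢v u≡v)
  ... | no ¬j = ⊥-elim (¬j (inj₁ (refl , refl)))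

  colour-vu : colour v u ≡ b
  colour-vu with joins? G u v v u
  ... | yes (inj₁ (v≡u , _)) = ⊥-elim (u≢v (sym v≡u))
  ... | yes (inj₂ _) = refl
  ... | no ¬j = ⊥-elim (¬j (inj₂ (refl , refl)))

  colour-kept : ∀ {x y} → Adj H x y → colour x y ≡ φ x y
  colour-kept {x} {y} e with joins? G u v x y
  ... | yes j = ⊥-elim (¬Adj-deleteEdge-Joins j e)
  ... | no _ = refl

  Seen : V → Fin Δ → Set
  Seen x c = ∃[ y ] (Adj G x y × (colour x y ≡ c ⊎ colour y x ≡ c))

  seen-in-H : ∀ {x c} → ∃[ y ] (Adj H x y × (φ x y ≡ c ⊎ φ y x ≡ c)) → Seen x c
  seen-in-H (y , e , inj₁ p) = y , deleteEdge-⊆ e , inj₁ (trans (colour-kept e) p)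
  seen-in-H (y , e , inj₂ p) = y , deleteEdge-⊆ e , inj₂ (trans (colour-kept (Adj-sym H e)) p)

  condA′ : ∀ x y → Adj G x y → colour x y ≢ colour y x
  condA′ x y e with Adj-deleteEdge-view e
  ... | inj₁ (inj₁ (refl , refl)) = λ eq → a≢b (trans (sym colour-uv) (trans eq colour-vu))
  ... | inj₁ (inj₂ (refl , refl)) = λ eq → a≢b (trans (sym colour-uv) (trans (sym eq) colour-vu))
  ... | inj₂ h = λ eq →
    condA x y h (trans (sym (colour-kept h)) (trans eq (colour-kept (Adj-sym H h))))

  condB′ : ∀ x y z → Adj G x y → Adj G x z → colour y x ≡ colour z x → y ≡ z
  condB′ x y z exy exz eq with endpoint-view x
  ... | inj₁ refl =
    injective-insert (colour-kept ∘ Adj-sym H) colour-vu b-fresh-at-u (condB u _ _)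
      (Adj-deleteEdge-at-u exy) (Adj-deleteEdge-at-u exz) eq
  ... | inj₂ (inj₁ refl) =
    injective-insert (colour-kept ∘ Adj-sym H) colour-uv a-fresh-at-v (condB v _ _)
      (Adj-deleteEdge-at-v exy) (Adj-deleteEdge-at-v exz) eq
  ... | inj₂ (inj₂ (x≢u , x≢v)) = condB x y z hy hz
    (trans (sym (colour-kept (Adj-sym H hy))) (trans eq (colour-kept (Adj-sym H hz))))
    where
    hy : Adj H x y
    hy = Adj-deleteEdge-elsewhere x≢u x≢v exy
    hz : Adj H x z
    hz = Adj-deleteEdge-elsewhere x≢u x≢v exz

  condC′ : ∀ x y z → Adj G x y → Adj G x z → colour x y ≡ colour x z → y ≡ z
  condC′ x y z exy exz eq with endpoint-view x
  ... | inj₁ refl =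
    injective-insert colour-kept colour-uv a-fresh-at-u (condC u _ _)
      (Adj-deleteEdge-at-u exy) (Adj-deleteEdge-at-u exz) eq
  ... | inj₂ (inj₁ refl) =
    injective-insert colour-kept colour-vu b-fresh-at-v (condC v _ _)
      (Adj-deleteEdge-at-v exy) (Adj-deleteEdge-at-v exz) eq
  ... | inj₂ (inj₂ (x≢u , x≢v)) = condC x y z hy hz
    (trans (sym (colour-kept hy)) (trans eq (colour-kept hz)))
    where
    hy : Adj H x y
    hy = Adj-deleteEdge-elsewhere x≢u x≢v exy
    hz : Adj H x z
    hz = Adj-deleteEdge-elsewhere x≢u x≢v exz

  condD′ : ∀ x → Δ ∸ 1 ≤ deg G x → ∀ c → Seen x c
  condD′ x big c with endpoint-view x
  ... | inj₁ refl =
    [ (λ c≡a → v , uv , inj₁ (trans colour-uv (sym c≡a)))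
    , [ (λ c≡b → v , uv , inj₂ (trans colour-vu (sym c≡b))) , seen-in-H ]′ ]′ (spans-u big c)
  ... | inj₂ (inj₁ refl) =
    [ (λ c≡b → u , Adj-sym G uv , inj₁ (trans colour-vu (sym c≡b)))
    , [ (λ c≡a → u , Adj-sym G uv , inj₂ (trans colour-uv (sym c≡a))) , seen-in-H ]′ ]′ (spans-v big c)
  ... | inj₂ (inj₂ (x≢u , x≢v)) =
    seen-in-H (condD x (subst (Δ ∸ 1 ≤_) (deg-deleteEdge-elsewhere x≢u x≢v) big) c)

  colouring : CondIncColoring G Δ
  colouring = record { φ = colour ; condA = condA′ ; condB = condB′ ; condC = condC′ ; condD = condD′ }

∸1≤⇒≤suc : ∀ Δ {m} → Δ ∸ 1 ≤ m → Δ ≤ suc m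
∸1≤⇒≤suc zero _ = z≤n
∸1≤⇒≤suc (suc Δ) le = s≤s le

suc≤∸2⇒3+≤ : ∀ Δ {m} → suc m ≤ Δ ∸ 2 → 3 + m ≤ Δ
suc≤∸2⇒3+≤ (suc (suc Δ)) le = s≤s (s≤s le)

module DegreeTwoEdge
  {G : Graph} {u v : Fin (n G)} (uv : Adj G u v) {Δ : ℕ}
  (deg-u : deg G u ≡ 2) (deg-v : deg G v ≤ Δ ∸ 2)
  (ψ : CondIncColoring (deleteEdge G u v) Δ)
  where

  open CondIncColoring ψ
  open DeletedEdge {G} {u} {v} uv

  private
    V : Set
    V = Fin (n G)
    H : Graph
    H = deleteEdge G u v

  deg-v≡suc : deg G v ≡ suc (deg H v)
  deg-v≡suc = deg-deleteEdge-Joins (inj₂ (refl , refl)) (Adj-sym G uv)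

  room : 3 + deg H v ≤ Δ
  room = suc≤∸2⇒3+≤ Δ (subst (_≤ Δ ∸ 2) deg-v≡suc deg-v)

  deg-H-u≡1 : deg H u ≡ 1
  deg-H-u≡1 = suc-injective (trans (sym (deg-deleteEdge-Joins (inj₁ (refl , refl)) uv)) deg-u)

  unique-neighbour-of-u : ∃[ w ] (Adj H u w × ∀ {y} → Adj H u y → y ≡ w)
  unique-neighbour-of-u = deg≡1⇒unique-neighbour H deg-H-u≡1

  w : V
  w = proj₁ unique-neighbour-of-u

  Adj-uw : Adj H u w
  Adj-uw = proj₁ (proj₂ unique-neighbour-of-u)

  ≡w : ∀ {y} → Adj H u y → y ≡ w
  ≡w = proj₂ (proj₂ unique-neighbour-of-u)

  ∃∉-two∷around-v : ∀ (c₁ c₂ : Fin Δ) (f : V → Fin Δ) → ∃[ c ] c ∉ c₁ ∷ c₂ ∷ map f (neighbours H v)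
  ∃∉-two∷around-v c₁ c₂ f = length<⇒∃∉ _
    (subst (_< Δ) (sym (cong (2 +_) (trans (length-map f (neighbours H v)) (length-neighbours H v)))) room)

  ∈-around-v : ∀ {c y} (f : V → Fin Δ) → Adj H v y → c ≡ f y → c ∈ map f (neighbours H v)
  ∈-around-v f e c≡ = Any-map (trans c≡) (∈-map⁺ f (∈-neighbours⁺ H e))

  a-avoiding : ∃[ c ] c ∉ φ u w ∷ φ w u ∷ map (λ y → φ y v) (neighbours H v)
  a-avoiding = ∃∉-two∷around-v (φ u w) (φ w u) (λ y → φ y v)

  a : Fin Δ
  a = proj₁ a-avoiding

  a∉ : a ∉ φ u w ∷ φ w u ∷ map (λ y → φ y v) (neighbours H v)
  a∉ = proj₂ a-avoiding

  b-avoiding : ∃[ c ] c ∉ a ∷ φ w u ∷ map (φ v) (neighbours H v)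
  b-avoiding = ∃∉-two∷around-v a (φ w u) (φ v)

  b : Fin Δ
  b = proj₁ b-avoiding

  b∉ : b ∉ a ∷ φ w u ∷ map (φ v) (neighbours H v)
  b∉ = proj₂ b-avoiding

  spans-u : Δ ∸ 1 ≤ deg G u → ∀ c → c ≡ a ⊎ c ≡ b ⊎ ∃[ y ] (Adj H u y × (φ u y ≡ c ⊎ φ y u ≡ c))
  spans-u big c = seen (Unique∧length≥⇒∈ distinct (∸1≤⇒≤suc Δ (subst (Δ ∸ 1 ≤_) deg-u big)) c)
    where
    distinct : Unique (a ∷ φ u w ∷ φ w u ∷ [])
    distinct = (a∉ ∘ here ∷ a∉ ∘ there ∘ here ∷ []) ∷ (condA u w Adj-uw ∷ []) ∷ [] ∷ []
    seen : c ∈ a ∷ φ u w ∷ φ w u ∷ [] → c ≡ a ⊎ c ≡ b ⊎ ∃[ y ] (Adj H u y × (φ u y ≡ c ⊎ φ y u ≡ c))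
    seen (here c≡a) = inj₁ c≡a
    seen (there (here c≡)) = inj₂ (inj₂ (w , Adj-uw , inj₁ (sym c≡)))
    seen (there (there (here c≡))) = inj₂ (inj₂ (w , Adj-uw , inj₂ (sym c≡)))

  spans-v : Δ ∸ 1 ≤ deg G v → ∀ c → c ≡ b ⊎ c ≡ a ⊎ ∃[ y ] (Adj H v y × (φ v y ≡ c ⊎ φ y v ≡ c))
  spans-v big = ⊥-elim (n≮n _ (≤-trans room (∸1≤⇒≤suc Δ (subst (Δ ∸ 1 ≤_) deg-v≡suc big))))

  colouring : CondIncColoring G Δ
  colouring = ExtendAcrossEdge.colouring uv ψ a b
    (λ a≡b → b∉ (here (sym a≡b)))
    (λ e a≡ → a∉ (here (trans a≡ (cong (φ u) (≡w e)))))
    (λ e b≡ → b∉ (there (here (trans b≡ (cong (λ y → φ y u) (≡w e))))))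
    (λ e b≡ → b∉ (there (there (∈-around-v (φ v) e b≡))))
    (λ e a≡ → a∉ (there (there (∈-around-v (λ y → φ y v) e a≡))))
    spans-u spans-v

lemma12 : (Δ : ℕ) → Δ > 0 → (G : Graph) → ρCritical Δ G →
          ¬ (∃[ u ] ∃[ v ] (Adj G u v × deg G u ≡ 2 × deg G v ≤ Δ ∸ 2))
lemma12 Δ _ G (_ , uncolourable , proper-subgraphs-colourable) (u , v , uv , deg-u , deg-v) =
  uncolourable (DegreeTwoEdge.colouring uv deg-u deg-v colouring-of-G−uv)
  where
  open DeletedEdge {G} {u} {v} uv
  colouring-of-G−uv : CondIncColoring (deleteEdge G u v) Δ
  colouring-of-G−uv = proper-subgraphs-colourable (deleteEdge G u v)
                        deleteEdge-embedding deleteEdge-proper
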